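{- Let $L\cong M\perp K$ be a $\mathbb{Z}_2$-lattice, where $M$ is a proper unimodular lattice of rank $2$ and the scale of $K$ is contained in $2\mathbb{Z}_2$. If $L$ is $\mathbb{Z}_2$-universal, then the norm of $K$ equals $2\mathbb{Z}_2$.
   Context: A $\mathbb{Z}_2$-lattice is a finitely generated $\mathbb{Z}_2$-submodule of a nondegenerate quadratic space over $\mathbb{Q}_2$ with quadratic map $q$ and bilinear form $B$, $q(v)=B(v,v)$. A proper unimodular lattice of rank 2 is one with an orthogonal basis $v_1,v_2$ with $q(v_1),q(v_2)\in\mathbb{Z}_2^\times$. The scale of $K$ is the ideal generated by $B(K,K)$ and the norm of $K$ is the ideal generated by $q(K)$. $L$ is $\mathbb{Z}_2$-universal if $q(L)=\mathbb{Z}_2$. -}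

module Defs where

open import Data.Nat as ℕ using (ℕ; zero; suc; ⌊_/2⌋; _%_; _≡ᵇ_; _^_)
open import Data.Bool using (Bool; true; false; if_then_else_)
open import Data.Fin using (Fin; splitAt) renaming (zero to f0; suc to fs)
open import Data.Sum using (_⊎_; inj₁; inj₂)
open import Data.Product using (Σ; ∃; _×_; _,_; proj₁; proj₂)
open import Data.List using (List; foldr)
open import Data.List.Relation.Unary.All using (All)
open import Relation.Binary.PropositionalEquality using (_≡_; refl)

-- The 2-adic integers ℤ₂, as streams of binary digits
-- (x = Σ_k x(k)·2^k), with pointwise (setoid) equality.

ℤ₂ : Set
ℤ₂ = ℕ → Bool

infix 4 _≈_
_≈_ : ℤ₂ → ℤ₂ → Set
x ≈ y = ∀ k → x k ≡ y k

trunc : ℤ₂ → ℕ → ℕ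
trunc x zero    = 0
trunc x (suc n) = trunc x n ℕ.+ (if x n then 2 ^ n else 0)

halfIter : ℕ → ℕ → ℕ
halfIter zero    s = s
halfIter (suc k) s = halfIter k ⌊ s /2⌋

bit : ℕ → ℕ → Bool
bit s k = (halfIter k s % 2) ≡ᵇ 1

fromℕ : ℕ → ℤ₂
fromℕ s = bit s

0ℤ₂ 1ℤ₂ 2ℤ₂ : ℤ₂
0ℤ₂ = fromℕ 0
1ℤ₂ = fromℕ 1
2ℤ₂ = fromℕ 2

infixl 6 _+₂_
infixl 7 _*₂_
_+₂_ : ℤ₂ → ℤ₂ → ℤ₂
(x +₂ y) k = bit (trunc x (suc k) ℕ.+ trunc y (suc k)) k

_*₂_ : ℤ₂ → ℤ₂ → ℤ₂
(x *₂ y) k = bit (trunc x (suc k) ℕ.* trunc y (suc k)) k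

IsUnit : ℤ₂ → Set
IsUnit x = Σ ℤ₂ λ y → x *₂ y ≈ 1ℤ₂

In2ℤ₂ : ℤ₂ → Set
In2ℤ₂ z = Σ ℤ₂ λ w → z ≈ 2ℤ₂ *₂ w

InIdealGen : (ℤ₂ → Set) → ℤ₂ → Set
InIdealGen S z =
  Σ (List (ℤ₂ × ℤ₂)) λ cs →
    All (λ p → S (proj₂ p)) cs ×
    (foldr (λ p acc → proj₁ p *₂ proj₂ p +₂ acc) 0ℤ₂ cs ≈ z)

Σf : (n : ℕ) → (Fin n → ℤ₂) → ℤ₂
Σf zero    f = 0ℤ₂
Σf (suc n) f = f f0 +₂ Σf n (λ i → f (fs i))

-- ℤ₂-lattices of rank n: the free module ℤ₂ⁿ with a symmetric
-- bilinear form given by its Gram matrix.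

record Lattice (n : ℕ) : Set where
  field
    gram : Fin n → Fin n → ℤ₂
    sym  : ∀ i j → gram i j ≈ gram j i

Vec₂ : ℕ → Set
Vec₂ n = Fin n → ℤ₂

module _ {n : ℕ} (L : Lattice n) where
  open Lattice L

  B : Vec₂ n → Vec₂ n → ℤ₂
  B x y = Σf n λ i → Σf n λ j → x i *₂ gram i j *₂ y j

  q : Vec₂ n → ℤ₂
  q v = B v v

  QValue : ℤ₂ → Set
  QValue z = Σ (Vec₂ n) λ v → q v ≈ z

  BValue : ℤ₂ → Set
  BValue z = Σ (Vec₂ n) λ x → Σ (Vec₂ n) λ y → B x y ≈ z

  ScaleIn2ℤ₂ : Set
  ScaleIn2ℤ₂ = ∀ z → InIdealGen BValue z → In2ℤ₂ z

  NormEq2ℤ₂ : Set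
  NormEq2ℤ₂ = ∀ z → (InIdealGen QValue z → In2ℤ₂ z) × (In2ℤ₂ z → InIdealGen QValue z)

  Universal : Set
  Universal = ∀ z → QValue z

infixl 6 _+ᵥ_
infixl 7 _·ᵥ_
infix 4 _≈ᵥ_
_·ᵥ_ : {n : ℕ} → ℤ₂ → Vec₂ n → Vec₂ n
(a ·ᵥ v) i = a *₂ v i

_+ᵥ_ : {n : ℕ} → Vec₂ n → Vec₂ n → Vec₂ n
(u +ᵥ v) i = u i +₂ v i

_≈ᵥ_ : {n : ℕ} → Vec₂ n → Vec₂ n → Set
u ≈ᵥ v = ∀ i → u i ≈ v i

zeroᵥ : {n : ℕ} → Vec₂ n
zeroᵥ i = 0ℤ₂

IsBasis2 : Vec₂ 2 → Vec₂ 2 → Set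
IsBasis2 v₁ v₂ =
  (∀ x → Σ ℤ₂ λ a → Σ ℤ₂ λ b → x ≈ᵥ (a ·ᵥ v₁) +ᵥ (b ·ᵥ v₂)) ×
  (∀ a b → (a ·ᵥ v₁) +ᵥ (b ·ᵥ v₂) ≈ᵥ zeroᵥ → (a ≈ 0ℤ₂) × (b ≈ 0ℤ₂))

ProperUnimodular2 : Lattice 2 → Set
ProperUnimodular2 M =
  Σ (Vec₂ 2) λ v₁ → Σ (Vec₂ 2) λ v₂ →
    IsBasis2 v₁ v₂ × (B M v₁ v₂ ≈ 0ℤ₂) × IsUnit (q M v₁) × IsUnit (q M v₂)

⊥gram : {m n : ℕ} → Lattice m → Lattice n → Fin (m ℕ.+ n) → Fin (m ℕ.+ n) → ℤ₂
⊥gram {m} M K i j with splitAt m i | splitAt m j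
... | inj₁ a | inj₁ b = Lattice.gram M a b
... | inj₂ a | inj₂ b = Lattice.gram K a b
... | inj₁ _ | inj₂ _ = 0ℤ₂
... | inj₂ _ | inj₁ _ = 0ℤ₂

⊥sym : {m n : ℕ} (M : Lattice m) (K : Lattice n) → ∀ i j → ⊥gram M K i j ≈ ⊥gram M K j i
⊥sym {m} M K i j with splitAt m i | splitAt m j
... | inj₁ a | inj₁ b = Lattice.sym M a b
... | inj₂ a | inj₂ b = Lattice.sym K a b
... | inj₁ _ | inj₂ _ = λ _ → refl
... | inj₂ _ | inj₁ _ = λ _ → refl

infixr 5 _⊥_
_⊥_ : {m n : ℕ} → Lattice m → Lattice n → Lattice (m ℕ.+ n)
M ⊥ K = record { gram = ⊥gram M K ; sym = ⊥sym M K }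

module Submission where

-- The inclusion norm K ⊆ 2ℤ₂ holds because q(K) ⊆ B(K,K).  For the converse
-- we reduce modulo 4.  Reduction ℤ₂ → ℤ/4 is a ring homomorphism; with an
-- orthogonal basis v₁, v₂ of M of unit norms u₁, u₂ it gives
--   q_L(a v₁ + b v₂ + w) ≡ a² u₁ + b² u₂ + q_K(w)  (mod 4),
-- where q_K(w) is even.  As squares are 0 or 1 mod 4, a finite check yields a
-- residue t that this expression attains only when q_K(w) ≡ 2 (mod 4).
-- Universality provides such a vector, hence κ = q_K(w) ≡ 2 (mod 4), and
-- every element of 2ℤ₂ is a multiple of κ: the quotient is built digit by digit.

open import Defs
open import Data.Bool using (Bool; true; false; not; if_then_else_; _xor_)
open import Data.Bool.Properties using (xor-assoc; xor-same; xor-identityʳ) renaming (_≟_ to _≟𝔹_)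
open import Data.Nat using (ℕ; zero; suc; _+_; _*_; _^_; _<_; _≤_; z≤n; s≤s; ⌊_/2⌋; _%_; _≡ᵇ_)
open import Data.Nat.Properties
  using (+-suc; +-identityʳ; *-identityˡ; *-identityʳ; *-zeroʳ; +-comm; *-suc; *-assoc; ≤-pred; +-mono-<-≤; ≤-refl; m^n>0; module ≤-Reasoning)
open import Data.Nat.DivMod using ([m+kn]%n≡m%n)
open import Data.Nat.Tactic.RingSolver using (solve-∀)
open import Data.Product using (Σ; _×_; _,_; proj₁; proj₂)
open import Data.List using ([]; _∷_)
open import Data.List.Relation.Unary.All as All using ([]; _∷_)
open import Data.Fin using (Fin; toℕ; _≟_; #_; _↑ˡ_; _↑ʳ_) renaming (zero to f0; suc to fs)
open import Data.Fin.Properties using (all?; any?)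
open import Relation.Binary.PropositionalEquality
  using (_≡_; refl; sym; trans; cong; cong₂; subst; isEquivalence; module ≡-Reasoning)
open import Relation.Nullary.Decidable using (Dec; map′; _×-dec_; _→-dec_; from-yes)
open import Level using (0ℓ)
open import Algebra.Bundles using (CommutativeRing)
import Algebra.Solver.Ring.AlmostCommutativeRing as ACR
import Algebra.Solver.Ring.Simple as Solver

half-+ : ∀ s y → ⌊ s + 2 * y /2⌋ ≡ ⌊ s /2⌋ + y
half-+ s zero    = trans (cong ⌊_/2⌋ (+-identityʳ s)) (sym (+-identityʳ ⌊ s /2⌋))
half-+ s (suc y) = begin
  ⌊ s + 2 * suc y /2⌋          ≡⟨ cong ⌊_/2⌋ s+2[1+y] ⟩
  suc ⌊ s + 2 * y /2⌋          ≡⟨ cong suc (half-+ s y) ⟩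
  suc (⌊ s /2⌋ + y)            ≡⟨ sym (+-suc ⌊ s /2⌋ y) ⟩
  ⌊ s /2⌋ + suc y              ∎
  where
  open ≡-Reasoning
  s+2[1+y] : s + 2 * suc y ≡ suc (suc (s + 2 * y))
  s+2[1+y] = trans (cong (s +_) (*-suc 2 y)) (trans (+-suc s _) (cong suc (+-suc s _)))

halfIter-+ : ∀ j s X → halfIter j (s + 2 ^ j * X) ≡ halfIter j s + X
halfIter-+ zero    s X = cong (s +_) (*-identityˡ X)
halfIter-+ (suc j) s X = begin
  halfIter j ⌊ s + 2 * 2 ^ j * X /2⌋     ≡⟨ cong (λ u → halfIter j ⌊ s + u /2⌋) (*-assoc 2 (2 ^ j) X) ⟩
  halfIter j ⌊ s + 2 * (2 ^ j * X) /2⌋   ≡⟨ cong (halfIter j) (half-+ s (2 ^ j * X)) ⟩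
  halfIter j (⌊ s /2⌋ + 2 ^ j * X)       ≡⟨ halfIter-+ j ⌊ s /2⌋ X ⟩
  halfIter j ⌊ s /2⌋ + X                 ∎
  where open ≡-Reasoning

half-< : ∀ t m → t < m + m → ⌊ t /2⌋ < m
half-< zero          (suc m) _       = s≤s z≤n
half-< (suc zero)    (suc m) _       = s≤s z≤n
half-< (suc (suc t)) (suc m) (s≤s p) = s≤s (half-< t m (≤-pred (subst (suc (suc t) ≤_) (+-suc m m) p)))

halfIter-< : ∀ j t → t < 2 ^ j → halfIter j t ≡ 0
halfIter-< zero    zero    _         = refl
halfIter-< zero    (suc t) (s≤s ())
halfIter-< (suc j) t       t<2^[1+j] =
  halfIter-< j ⌊ t /2⌋ (half-< t (2 ^ j) (subst (t <_) (cong (2 ^ j +_) (+-identityʳ (2 ^ j))) t<2^[1+j]))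

bit-< : ∀ j t → t < 2 ^ j → bit t j ≡ false
bit-< j t t<2^j = cong (λ u → u % 2 ≡ᵇ 1) (halfIter-< j t t<2^j)

bit-+-high : ∀ s j X → bit (s + 2 ^ suc j * X) j ≡ bit s j
bit-+-high s j X = cong (_≡ᵇ 1) (begin
  halfIter j (s + 2 ^ suc j * X) % 2    ≡⟨ cong (λ u → halfIter j (s + u) % 2) (regroup (2 ^ j) X) ⟩
  halfIter j (s + 2 ^ j * (X * 2)) % 2  ≡⟨ cong (_% 2) (halfIter-+ j s (X * 2)) ⟩
  (halfIter j s + X * 2) % 2            ≡⟨ [m+kn]%n≡m%n (halfIter j s) X 2 ⟩
  halfIter j s % 2                      ∎)
  where
  open ≡-Reasoning
  regroup : ∀ p X → 2 * p * X ≡ p * (X * 2)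
  regroup = solve-∀

%2-skip : ∀ k → suc (suc k) % 2 ≡ k % 2
%2-skip k = trans (cong (_% 2) (+-comm 2 k)) ([m+kn]%n≡m%n k 1 2)

parity-suc : ∀ m → (suc m % 2 ≡ᵇ 1) ≡ not (m % 2 ≡ᵇ 1)
parity-suc zero          = refl
parity-suc (suc zero)    = refl
parity-suc (suc (suc m)) rewrite %2-skip (suc m) | %2-skip m = parity-suc m

bit-+-flip : ∀ s j → bit (s + 2 ^ j) j ≡ not (bit s j)
bit-+-flip s j = begin
  bit (s + 2 ^ j) j                      ≡⟨ cong (λ u → halfIter j (s + u) % 2 ≡ᵇ 1) (sym (*-identityʳ (2 ^ j))) ⟩
  (halfIter j (s + 2 ^ j * 1) % 2 ≡ᵇ 1)  ≡⟨ cong (λ u → u % 2 ≡ᵇ 1) (trans (halfIter-+ j s 1) (+-comm (halfIter j s) 1)) ⟩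
  (suc (halfIter j s) % 2 ≡ᵇ 1)          ≡⟨ parity-suc (halfIter j s) ⟩
  not (bit s j)                          ∎
  where open ≡-Reasoning

trunc-< : ∀ x k → trunc x k < 2 ^ k
trunc-< x zero    = s≤s z≤n
trunc-< x (suc k) = begin-strict
  trunc x k + (if x k then 2 ^ k else 0)  <⟨ +-mono-<-≤ (trunc-< x k) (digit≤ (x k)) ⟩
  2 ^ k + 2 ^ k                           ≡⟨ cong (2 ^ k +_) (sym (+-identityʳ (2 ^ k))) ⟩
  2 ^ suc k                               ∎
  where
  open ≤-Reasoning
  digit≤ : ∀ b → (if b then 2 ^ k else 0) ≤ 2 ^ k
  digit≤ true  = ≤-refl
  digit≤ false = z≤n

bit-trunc : ∀ x k → bit (trunc x (suc k)) k ≡ x k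
bit-trunc x k with x k
... | true  = trans (bit-+-flip (trunc x k) k) (cong not (bit-< k _ (trunc-< x k)))
... | false = trans (cong (λ u → bit u k) (+-identityʳ (trunc x k))) (bit-< k _ (trunc-< x k))

digit-0ℤ₂ : ∀ i → 0ℤ₂ i ≡ false
digit-0ℤ₂ i = bit-< i 0 (m^n>0 2 i)

trunc-0ℤ₂ : ∀ m → trunc 0ℤ₂ m ≡ 0
trunc-0ℤ₂ zero = refl
trunc-0ℤ₂ (suc m) rewrite trunc-0ℤ₂ m | digit-0ℤ₂ m = refl

-- 1 has no digits beyond the first (digit i+1 of 1 is digit i of 0).
trunc-1ℤ₂ : ∀ m → trunc 1ℤ₂ (suc m) ≡ 1
trunc-1ℤ₂ zero = refl
trunc-1ℤ₂ (suc m) rewrite trunc-1ℤ₂ m | digit-0ℤ₂ m = refl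

+₂-identityʳ : ∀ x → x +₂ 0ℤ₂ ≈ x
+₂-identityʳ x m rewrite trunc-0ℤ₂ (suc m) | +-identityʳ (trunc x (suc m)) = bit-trunc x m

*₂-identityˡ : ∀ x → 1ℤ₂ *₂ x ≈ x
*₂-identityˡ x m rewrite trunc-1ℤ₂ m | *-identityˡ (trunc x (suc m)) = bit-trunc x m

multiple∈ideal : ∀ {S : ℤ₂ → Set} {y z} c → S y → c *₂ y ≈ z → InIdealGen S z
multiple∈ideal {y = y} c Sy cy≈z = ((c , y) ∷ []) , (Sy ∷ []) , λ m → trans (+₂-identityʳ (c *₂ y) m) (cy≈z m)

-- Multiplying by K = 2 + 4Y, adding
-- 2^n to a factor flips digit n+1 of the product while adding 2^(n+1) keeps
-- it; so the digits of a quotient can be chosen one at a time.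

flip-step : ∀ t Y n → bit ((t + 2 ^ n) * (2 + 4 * Y)) (suc n) ≡ not (bit (t * (2 + 4 * Y)) (suc n))
flip-step t Y n = begin
  bit ((t + 2 ^ n) * (2 + 4 * Y)) (suc n)                                ≡⟨ cong (λ u → bit u (suc n)) (expand t Y (2 ^ n)) ⟩
  bit ((t * (2 + 4 * Y) + 2 ^ suc n) + 2 ^ suc (suc n) * Y) (suc n)     ≡⟨ bit-+-high _ (suc n) Y ⟩
  bit (t * (2 + 4 * Y) + 2 ^ suc n) (suc n)                              ≡⟨ bit-+-flip _ (suc n) ⟩
  not (bit (t * (2 + 4 * Y)) (suc n))                                    ∎
  where
  open ≡-Reasoning
  expand : ∀ t Y p → (t + p) * (2 + 4 * Y) ≡ (t * (2 + 4 * Y) + 2 * p) + 2 * (2 * p) * Y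
  expand = solve-∀

keep-step : ∀ t Y n → bit ((t + 2 ^ suc n) * (2 + 4 * Y)) (suc n) ≡ bit (t * (2 + 4 * Y)) (suc n)
keep-step t Y n =
  trans (cong (λ u → bit u (suc n)) (expand t Y (2 ^ n))) (bit-+-high _ (suc n) (1 + 2 * Y))
  where
  expand : ∀ t Y p → (t + 2 * p) * (2 + 4 * Y) ≡ t * (2 + 4 * Y) + 2 * (2 * p) * (1 + 2 * Y)
  expand = solve-∀

digit-step : ∀ t K Y n d e → K ≡ 2 + 4 * Y →
  bit (((t + (if d then 2 ^ n else 0)) + (if e then 2 ^ suc n else 0)) * K) (suc n) ≡ d xor bit (t * K) (suc n)
digit-step t _ Y n d e refl = trans (drop-high e) (drop-low d)
  where
  K : ℕ
  K = 2 + 4 * Y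
  drop-high : ∀ e → bit (((t + (if d then 2 ^ n else 0)) + (if e then 2 ^ suc n else 0)) * K) (suc n)
                  ≡ bit ((t + (if d then 2 ^ n else 0)) * K) (suc n)
  drop-high true  = keep-step (t + (if d then 2 ^ n else 0)) Y n
  drop-high false = cong (λ u → bit (u * K) (suc n)) (+-identityʳ (t + (if d then 2 ^ n else 0)))
  drop-low : ∀ d → bit ((t + (if d then 2 ^ n else 0)) * K) (suc n) ≡ d xor bit (t * K) (suc n)
  drop-low true  = flip-step t Y n
  drop-low false = cong (λ u → bit (u * K) (suc n)) (+-identityʳ t)

Is2mod4 : ℤ₂ → Set
Is2mod4 κ = (κ 0 ≡ false) × (κ 1 ≡ true)

trunc-2mod4 : ∀ κ → Is2mod4 κ → ∀ n → Σ ℕ λ Y → trunc κ (2 + n) ≡ 2 + 4 * Y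
trunc-2mod4 κ (κ₀ , κ₁) zero rewrite κ₀ | κ₁ = 0 , refl
trunc-2mod4 κ κ≡2 (suc n) with trunc-2mod4 κ κ≡2 n | κ (2 + n)
... | Y , eq | true  = Y + 2 ^ n , trans (cong (_+ 2 ^ (2 + n)) eq) (regroup Y (2 ^ n))
  where
  regroup : ∀ Y p → 2 + 4 * Y + 2 * (2 * p) ≡ 2 + 4 * (Y + p)
  regroup = solve-∀
... | Y , eq | false = Y , trans (+-identityʳ _) eq

module Quotient (κ z : ℤ₂) (κ≡2 : Is2mod4 κ) (z₀ : z 0 ≡ false) where
  -- digit n of the quotient, given its truncation t below 2^n: it corrects
  -- digit n+1 of the product to that of z
  next-digit : ℕ → ℕ → Bool
  next-digit n t = z (suc n) xor bit (t * trunc κ (2 + n)) (suc n)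

  partial : ℕ → ℕ
  partial zero    = 0
  partial (suc n) = partial n + (if next-digit n (partial n) then 2 ^ n else 0)

  c : ℤ₂
  c n = next-digit n (partial n)

  trunc-c : ∀ n → trunc c n ≡ partial n
  trunc-c zero    = refl
  trunc-c (suc n) = cong (_+ (if c n then 2 ^ n else 0)) (trunc-c n)

  quotient : c *₂ κ ≈ z
  -- digit 0 of c·κ is 0 since κ is even; digit n+1 is fixed by next-digit
  quotient zero rewrite proj₁ κ≡2 | *-zeroʳ (trunc c 1) = sym z₀
  quotient (suc n) = begin
    bit (trunc c (2 + n) * K) (suc n)                                   ≡⟨ cong (λ t → bit ((t + (if c (suc n) then 2 ^ suc n else 0)) * K) (suc n)) (trunc-c (suc n)) ⟩
    bit ((partial (suc n) + (if c (suc n) then 2 ^ suc n else 0)) * K) (suc n) ≡⟨ digit-step (partial n) K (proj₁ K≡) n (c n) (c (suc n)) (proj₂ K≡) ⟩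
    (z (suc n) xor b) xor b                                             ≡⟨ xor-assoc (z (suc n)) b b ⟩
    z (suc n) xor (b xor b)                                             ≡⟨ cong (z (suc n) xor_) (xor-same b) ⟩
    z (suc n) xor false                                                 ≡⟨ xor-identityʳ (z (suc n)) ⟩
    z (suc n)                                                           ∎
    where
    open ≡-Reasoning
    K : ℕ
    K = trunc κ (2 + n)
    K≡ : Σ ℕ λ Y → K ≡ 2 + 4 * Y
    K≡ = trunc-2mod4 κ κ≡2 n
    b : Bool
    b = bit (partial n * K) (suc n)

Z4 : Set
Z4 = Fin 4

mod4 : ℕ → Z4
mod4 0 = # 0
mod4 1 = # 1
mod4 2 = # 2
mod4 3 = # 3
mod4 (suc (suc (suc (suc m)))) = mod4 m

infixl 6 _⊕_
infixl 7 _⊗_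
_⊕_ _⊗_ : Z4 → Z4 → Z4
r ⊕ s = mod4 (toℕ r + toℕ s)
r ⊗ s = mod4 (toℕ r * toℕ s)

⊖_ : Z4 → Z4
⊖ r = mod4 (3 * toℕ r)

Z4-commutativeRing : CommutativeRing 0ℓ 0ℓ
Z4-commutativeRing = record
  { Carrier = Z4 ; _≈_ = _≡_ ; _+_ = _⊕_ ; _*_ = _⊗_ ; -_ = ⊖_ ; 0# = # 0 ; 1# = # 1
  ; isCommutativeRing = record
    { isRing = record
      { +-isAbelianGroup = record
        { isGroup = record
          { isMonoid = record
            { isSemigroup = record
              { isMagma = record { isEquivalence = isEquivalence ; ∙-cong = cong₂ _⊕_ }
              ; assoc = from-yes (all? λ x → all? λ y → all? λ z → x ⊕ y ⊕ z ≟ x ⊕ (y ⊕ z)) }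
            ; identity = from-yes (all? λ x → # 0 ⊕ x ≟ x) , from-yes (all? λ x → x ⊕ # 0 ≟ x) }
          ; inverse = from-yes (all? λ x → ⊖ x ⊕ x ≟ # 0) , from-yes (all? λ x → x ⊕ ⊖ x ≟ # 0)
          ; ⁻¹-cong = cong ⊖_ }
        ; comm = from-yes (all? λ x → all? λ y → x ⊕ y ≟ y ⊕ x) }
      ; *-cong = cong₂ _⊗_
      ; *-assoc = from-yes (all? λ x → all? λ y → all? λ z → x ⊗ y ⊗ z ≟ x ⊗ (y ⊗ z))
      ; *-identity = from-yes (all? λ x → # 1 ⊗ x ≟ x) , from-yes (all? λ x → x ⊗ # 1 ≟ x)
      ; distrib = from-yes (all? λ x → all? λ y → all? λ z → x ⊗ (y ⊕ z) ≟ x ⊗ y ⊕ x ⊗ z)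
                , from-yes (all? λ x → all? λ y → all? λ z → (y ⊕ z) ⊗ x ≟ y ⊗ x ⊕ z ⊗ x) }
    ; *-comm = from-yes (all? λ x → all? λ y → x ⊗ y ≟ y ⊗ x) } }

open CommutativeRing Z4-commutativeRing
  using () renaming (+-assoc to ⊕-assoc; +-identityʳ to ⊕-identityʳ; zeroʳ to ⊗-zeroʳ)
open Solver (ACR.fromCommutativeRing Z4-commutativeRing) _≟_ using (solve; _:+_; _:*_; _:=_; con)

all𝔹? : {P : Bool → Set} → (∀ b → Dec (P b)) → Dec (∀ b → P b)
all𝔹? P? = map′ (λ { (f , t) false → f ; (f , t) true → t }) (λ g → g false , g true) (P? false ×-dec P? true)

residue : Bool → Bool → Z4
residue false false = # 0
residue true  false = # 1
residue false true  = # 2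
residue true  true  = # 3

reduce : ℤ₂ → Z4
reduce x = residue (x 0) (x 1)

digits : Bool → Bool → ℤ₂
digits a b zero          = a
digits a b (suc zero)    = b
digits a b (suc (suc _)) = false

-- The first two digits of x +₂ y and x *₂ y only depend on those of x and y,
-- so reduction is a ring homomorphism by a check over the digits.
reduce-+ : ∀ x y → reduce (x +₂ y) ≡ reduce x ⊕ reduce y
reduce-+ x y = on-digits (x 0) (x 1) (y 0) (y 1)
  where
  on-digits : ∀ a b c d → reduce (digits a b +₂ digits c d) ≡ residue a b ⊕ residue c d
  on-digits = from-yes (all𝔹? λ a → all𝔹? λ b → all𝔹? λ c → all𝔹? λ d →
    reduce (digits a b +₂ digits c d) ≟ residue a b ⊕ residue c d)

reduce-* : ∀ x y → reduce (x *₂ y) ≡ reduce x ⊗ reduce y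
reduce-* x y = on-digits (x 0) (x 1) (y 0) (y 1)
  where
  on-digits : ∀ a b c d → reduce (digits a b *₂ digits c d) ≡ residue a b ⊗ residue c d
  on-digits = from-yes (all𝔹? λ a → all𝔹? λ b → all𝔹? λ c → all𝔹? λ d →
    reduce (digits a b *₂ digits c d) ≟ residue a b ⊗ residue c d)

reduce-≈ : ∀ {x y} → x ≈ y → reduce x ≡ reduce y
reduce-≈ x≈y = cong₂ residue (x≈y 0) (x≈y 1)

reduce-fromℕ : ∀ t → reduce (fromℕ (toℕ t)) ≡ t
reduce-fromℕ = from-yes (all? λ t → reduce (fromℕ (toℕ t)) ≟ t)

Σ₄ : (n : ℕ) → (Fin n → Z4) → Z4
Σ₄ zero    f = # 0
Σ₄ (suc n) f = f f0 ⊕ Σ₄ n (λ i → f (fs i))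

Σ₄-cong : ∀ n {f g : Fin n → Z4} → (∀ i → f i ≡ g i) → Σ₄ n f ≡ Σ₄ n g
Σ₄-cong zero    f≡g = refl
Σ₄-cong (suc n) f≡g = cong₂ _⊕_ (f≡g f0) (Σ₄-cong n (λ i → f≡g (fs i)))

reduce-Σ : ∀ n (f : Fin n → ℤ₂) → reduce (Σf n f) ≡ Σ₄ n (λ i → reduce (f i))
reduce-Σ zero    f = refl
reduce-Σ (suc n) f = trans (reduce-+ (f f0) (Σf n (λ i → f (fs i)))) (cong (reduce (f f0) ⊕_) (reduce-Σ n (λ i → f (fs i))))

form₄ : {n : ℕ} → (Fin n → Fin n → Z4) → (Fin n → Z4) → (Fin n → Z4) → Z4
form₄ {n} g x y = Σ₄ n λ i → Σ₄ n λ j → x i ⊗ g i j ⊗ y j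

gram₄ : {n : ℕ} → Lattice n → Fin n → Fin n → Z4
gram₄ L i j = reduce (Lattice.gram L i j)

reduce-B : ∀ {n} (L : Lattice n) (x y : Vec₂ n) →
  reduce (B L x y) ≡ form₄ (gram₄ L) (λ i → reduce (x i)) (λ j → reduce (y j))
reduce-B {n} L x y = trans (reduce-Σ n _) (Σ₄-cong n λ i → trans (reduce-Σ n _) (Σ₄-cong n λ j →
  trans (reduce-* (x i *₂ Lattice.gram L i j) (y j)) (cong (_⊗ reduce (y j)) (reduce-* (x i) (Lattice.gram L i j)))))

compM : {n : ℕ} → Vec₂ (2 + n) → Vec₂ 2
compM {n} v i = v (i ↑ˡ n)

compK : {n : ℕ} → Vec₂ (2 + n) → Vec₂ n
compK v j = v (2 ↑ʳ j)

zero-block : ∀ n a (y : Fin n → Z4) → Σ₄ n (λ j → a ⊗ # 0 ⊗ y j) ≡ # 0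
zero-block zero    a y = refl
zero-block (suc n) a y = cong₂ _⊕_ (annihilate a (y f0)) (zero-block n a (λ j → y (fs j)))
  where
  annihilate : ∀ a b → a ⊗ # 0 ⊗ b ≡ # 0
  annihilate = from-yes (all? λ a → all? λ b → a ⊗ # 0 ⊗ b ≟ # 0)

q-⊥-mod4 : ∀ n (M : Lattice 2) (K : Lattice n) (v : Vec₂ (2 + n)) →
  reduce (q (M ⊥ K) v) ≡ reduce (q M (compM v)) ⊕ reduce (q K (compK v))
q-⊥-mod4 n M K v = begin
  reduce (q (M ⊥ K) v)                                               ≡⟨ reduce-B (M ⊥ K) v v ⟩
  (A ⊕ (B₀ ⊕ Σ₄ n (λ j → x₀ ⊗ # 0 ⊗ y j))) ⊕ ((C ⊕ (D ⊕ Σ₄ n (λ j → x₁ ⊗ # 0 ⊗ y j))) ⊕ Σ₄ n rowK)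
      ≡⟨ cong₂ (λ s t → (A ⊕ (B₀ ⊕ s)) ⊕ ((C ⊕ (D ⊕ t)) ⊕ Σ₄ n rowK)) (zero-block n x₀ y) (zero-block n x₁ y) ⟩
  (A ⊕ (B₀ ⊕ # 0)) ⊕ ((C ⊕ (D ⊕ # 0)) ⊕ Σ₄ n rowK)                    ≡⟨ sym (⊕-assoc (A ⊕ (B₀ ⊕ # 0)) _ _) ⟩
  ((A ⊕ (B₀ ⊕ # 0)) ⊕ (C ⊕ (D ⊕ # 0))) ⊕ Σ₄ n rowK                    ≡⟨ cong₂ (λ s t → ((A ⊕ (B₀ ⊕ # 0)) ⊕ s) ⊕ t) (sym (⊕-identityʳ _)) (Σ₄-cong n dropZeros) ⟩
  form₄ (gram₄ M) x x ⊕ form₄ (gram₄ K) y y                          ≡⟨ sym (cong₂ _⊕_ (reduce-B M (compM v) (compM v)) (reduce-B K (compK v) (compK v))) ⟩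
  reduce (q M (compM v)) ⊕ reduce (q K (compK v))                     ∎
  where
  open ≡-Reasoning
  x : Fin 2 → Z4
  x i = reduce (compM v i)
  x₀ x₁ : Z4
  x₀ = x f0
  x₁ = x (fs f0)
  y : Fin n → Z4
  y j = reduce (compK v j)
  g : Fin 2 → Fin 2 → Z4
  g = gram₄ M
  A B₀ C D : Z4
  A = x₀ ⊗ g f0 f0 ⊗ x₀
  B₀ = x₀ ⊗ g f0 (fs f0) ⊗ x₁
  C = x₁ ⊗ g (fs f0) f0 ⊗ x₀
  D = x₁ ⊗ g (fs f0) (fs f0) ⊗ x₁
  rowK : Fin n → Z4
  rowK i = y i ⊗ # 0 ⊗ x₀ ⊕ (y i ⊗ # 0 ⊗ x₁ ⊕ Σ₄ n (λ j → y i ⊗ gram₄ K i j ⊗ y j))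
  dropZeros : ∀ i → rowK i ≡ Σ₄ n (λ j → y i ⊗ gram₄ K i j ⊗ y j)
  dropZeros i = drop (y i) x₀ x₁ _
    where
    drop : ∀ a b c s → a ⊗ # 0 ⊗ b ⊕ (a ⊗ # 0 ⊗ c ⊕ s) ≡ s
    drop = from-yes (all? λ a → all? λ b → all? λ c → all? λ s → a ⊗ # 0 ⊗ b ⊕ (a ⊗ # 0 ⊗ c ⊕ s) ≟ s)

expand₂ : (g : Fin 2 → Fin 2 → Z4) → g (fs f0) f0 ≡ g f0 (fs f0) → ∀ a b (p r : Fin 2 → Z4) →
  form₄ g (λ i → a ⊗ p i ⊕ b ⊗ r i) (λ i → a ⊗ p i ⊕ b ⊗ r i)
    ≡ a ⊗ a ⊗ form₄ g p p ⊕ (a ⊗ b ⊕ a ⊗ b) ⊗ form₄ g p r ⊕ b ⊗ b ⊗ form₄ g r r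
expand₂ g g-sym a b p r = by-symmetry (g f0 f0) (g f0 (fs f0)) (g (fs f0) f0) (g (fs f0) (fs f0)) g-sym
  where
  x : Fin 2 → Z4
  x i = a ⊗ p i ⊕ b ⊗ r i
  mat : Z4 → Z4 → Z4 → Z4 → Fin 2 → Fin 2 → Z4
  mat g₀₀ g₀₁ g₁₀ g₁₁ f0      f0      = g₀₀
  mat g₀₀ g₀₁ g₁₀ g₁₁ f0      (fs _)  = g₀₁
  mat g₀₀ g₀₁ g₁₀ g₁₁ (fs _)  f0      = g₁₀
  mat g₀₀ g₀₁ g₁₀ g₁₁ (fs _)  (fs _)  = g₁₁
  by-symmetry : ∀ g₀₀ g₀₁ g₁₀ g₁₁ → g₁₀ ≡ g₀₁ → let h = mat g₀₀ g₀₁ g₁₀ g₁₁ in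
    form₄ h x x ≡ a ⊗ a ⊗ form₄ h p p ⊕ (a ⊗ b ⊕ a ⊗ b) ⊗ form₄ h p r ⊕ b ⊗ b ⊗ form₄ h r r
  by-symmetry g₀₀ g₀₁ .g₀₁ g₁₁ refl = solve 9 (λ a b p₀ p₁ r₀ r₁ g₀₀ g₀₁ g₁₁ →
    let Q = λ x₀ x₁ y₀ y₁ → (x₀ :* g₀₀ :* y₀ :+ (x₀ :* g₀₁ :* y₁ :+ con (# 0)))
                           :+ ((x₁ :* g₀₁ :* y₀ :+ (x₁ :* g₁₁ :* y₁ :+ con (# 0))) :+ con (# 0))
        x₀ = a :* p₀ :+ b :* r₀
        x₁ = a :* p₁ :+ b :* r₁
    in Q x₀ x₁ x₀ x₁ := a :* a :* Q p₀ p₁ p₀ p₁ :+ (a :* b :+ a :* b) :* Q p₀ p₁ r₀ r₁ :+ b :* b :* Q r₀ r₁ r₀ r₁)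
    refl a b (p f0) (p (fs f0)) (r f0) (r (fs f0)) g₀₀ g₀₁ g₁₁

form₄-cong : ∀ {n} (g : Fin n → Fin n → Z4) {x x′ y y′ : Fin n → Z4} →
  (∀ i → x i ≡ x′ i) → (∀ j → y j ≡ y′ j) → form₄ g x y ≡ form₄ g x′ y′
form₄-cong {n} g x≡ y≡ = Σ₄-cong n λ i → Σ₄-cong n λ j → cong₂ (λ s t → s ⊗ g i j ⊗ t) (x≡ i) (y≡ j)

q-diagonal-mod4 : (M : Lattice 2) (v₁ v₂ x : Vec₂ 2) (a b : ℤ₂) → B M v₁ v₂ ≈ 0ℤ₂ →
  x ≈ᵥ (a ·ᵥ v₁) +ᵥ (b ·ᵥ v₂) →
  reduce (q M x) ≡ reduce a ⊗ reduce a ⊗ reduce (q M v₁) ⊕ reduce b ⊗ reduce b ⊗ reduce (q M v₂)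
q-diagonal-mod4 M v₁ v₂ x a b v₁⊥v₂ x≈ = begin
  reduce (q M x)                                          ≡⟨ reduce-B M x x ⟩
  form₄ g (λ i → reduce (x i)) (λ i → reduce (x i))       ≡⟨ form₄-cong g coord coord ⟩
  form₄ g (λ i → α ⊗ p i ⊕ β ⊗ r i) (λ i → α ⊗ p i ⊕ β ⊗ r i)
                                                          ≡⟨ expand₂ g (reduce-≈ (Lattice.sym M (fs f0) f0)) α β p r ⟩
  α ⊗ α ⊗ form₄ g p p ⊕ (α ⊗ β ⊕ α ⊗ β) ⊗ form₄ g p r ⊕ β ⊗ β ⊗ form₄ g r r
                                                          ≡⟨ cong (λ s → α ⊗ α ⊗ form₄ g p p ⊕ (α ⊗ β ⊕ α ⊗ β) ⊗ s ⊕ β ⊗ β ⊗ form₄ g r r) p⊥r ⟩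
  α ⊗ α ⊗ form₄ g p p ⊕ (α ⊗ β ⊕ α ⊗ β) ⊗ # 0 ⊕ β ⊗ β ⊗ form₄ g r r
                                                          ≡⟨ cong (λ s → α ⊗ α ⊗ form₄ g p p ⊕ s ⊕ β ⊗ β ⊗ form₄ g r r) (⊗-zeroʳ (α ⊗ β ⊕ α ⊗ β)) ⟩
  α ⊗ α ⊗ form₄ g p p ⊕ # 0 ⊕ β ⊗ β ⊗ form₄ g r r
                                                          ≡⟨ cong₂ (λ s t → s ⊕ β ⊗ β ⊗ t) (⊕-identityʳ (α ⊗ α ⊗ form₄ g p p)) (sym (reduce-B M v₂ v₂)) ⟩
  α ⊗ α ⊗ form₄ g p p ⊕ β ⊗ β ⊗ reduce (q M v₂)           ≡⟨ cong (λ s → α ⊗ α ⊗ s ⊕ β ⊗ β ⊗ reduce (q M v₂)) (sym (reduce-B M v₁ v₁)) ⟩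
  α ⊗ α ⊗ reduce (q M v₁) ⊕ β ⊗ β ⊗ reduce (q M v₂)       ∎
  where
  open ≡-Reasoning
  g : Fin 2 → Fin 2 → Z4
  g = gram₄ M
  α β : Z4
  α = reduce a
  β = reduce b
  p r : Fin 2 → Z4
  p i = reduce (v₁ i)
  r i = reduce (v₂ i)
  coord : ∀ i → reduce (x i) ≡ α ⊗ p i ⊕ β ⊗ r i
  coord i = trans (reduce-≈ (x≈ i)) (trans (reduce-+ (a *₂ v₁ i) (b *₂ v₂ i)) (cong₂ _⊕_ (reduce-* a (v₁ i)) (reduce-* b (v₂ i))))
  p⊥r : form₄ g p r ≡ # 0
  p⊥r = trans (sym (reduce-B M v₁ v₂)) (reduce-≈ v₁⊥v₂)

IsUnit₄ : Z4 → Set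
IsUnit₄ u = Σ Z4 λ s → u ⊗ s ≡ # 1

reduce-unit : ∀ {x} → IsUnit x → IsUnit₄ (reduce x)
reduce-unit {x} (y , xy≈1) = reduce y , trans (sym (reduce-* x y)) (reduce-≈ xy≈1)

reduce-even : ∀ {x} → In2ℤ₂ x → Σ Z4 λ s → reduce x ≡ # 2 ⊗ s
reduce-even (w , x≈2w) = reduce w , trans (reduce-≈ x≈2w) (reduce-* 2ℤ₂ w)

even-digit₀ : ∀ {x} → In2ℤ₂ x → x 0 ≡ false
even-digit₀ (w , x≈2w) = x≈2w 0

digit₁-of-2 : ∀ x → reduce x ≡ # 2 → x 1 ≡ true
digit₁-of-2 x = on-digits (x 0) (x 1)
  where
  on-digits : ∀ a b → residue a b ≡ # 2 → b ≡ true
  on-digits = from-yes (all𝔹? λ a → all𝔹? λ b → (residue a b ≟ # 2) →-dec (b ≟𝔹 true))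

-- Squares in ℤ/4 are 0 or 1.  Hence for units u₁, u₂ some residue t is
-- reached by a² u₁ + b² u₂ + 2s only when 2s = 2.
missed-residue : ∀ u₁ u₂ → IsUnit₄ u₁ → IsUnit₄ u₂ →
  Σ Z4 λ t → ∀ a b s → a ⊗ a ⊗ u₁ ⊕ b ⊗ b ⊗ u₂ ⊕ # 2 ⊗ s ≡ t → # 2 ⊗ s ≡ # 2
missed-residue = from-yes (all? λ u₁ → all? λ u₂ →
  any? (λ s → u₁ ⊗ s ≟ # 1) →-dec any? (λ s → u₂ ⊗ s ≟ # 1) →-dec
  any? λ t → all? λ a → all? λ b → all? λ s →
  (a ⊗ a ⊗ u₁ ⊕ b ⊗ b ⊗ u₂ ⊕ # 2 ⊗ s ≟ t) →-dec (# 2 ⊗ s ≟ # 2))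

norm⊆scale : ∀ {n} (K : Lattice n) z → InIdealGen (QValue K) z → InIdealGen (BValue K) z
norm⊆scale K z (cs , gens , sum) = cs , All.map (λ { (w , qw≈) → w , w , qw≈ }) gens , sum

value-2mod4 : ∀ n (M : Lattice 2) (K : Lattice n) → ProperUnimodular2 M → ScaleIn2ℤ₂ K →
  Universal (M ⊥ K) → Σ (Vec₂ n) λ w → Is2mod4 (q K w)
value-2mod4 n M K (v₁ , v₂ , (spans , _) , v₁⊥v₂ , unit₁ , unit₂) scale universal =
  use (missed-residue u₁ u₂ (reduce-unit unit₁) (reduce-unit unit₂))
  where
  u₁ u₂ : Z4
  u₁ = reduce (q M v₁)
  u₂ = reduce (q M v₂)
  use : (Σ Z4 λ t → ∀ a b s → a ⊗ a ⊗ u₁ ⊕ b ⊗ b ⊗ u₂ ⊕ # 2 ⊗ s ≡ t → # 2 ⊗ s ≡ # 2) →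
        Σ (Vec₂ n) λ w → Is2mod4 (q K w)
  use (t , forced) = use-coordinates (spans (compM v)) (reduce-even κ-even)
    where
    -- by universality q(v) = t for some v = (a v₁ + b v₂) ⊕ w in M ⊥ K
    v : Vec₂ (2 + n)
    v = proj₁ (universal (fromℕ (toℕ t)))
    κ : ℤ₂
    κ = q K (compK v)
    κ-even : In2ℤ₂ κ
    κ-even = scale κ (norm⊆scale K κ (multiple∈ideal 1ℤ₂ (compK v , λ _ → refl) (*₂-identityˡ κ)))
    use-coordinates : (Σ ℤ₂ λ a → Σ ℤ₂ λ b → compM v ≈ᵥ (a ·ᵥ v₁) +ᵥ (b ·ᵥ v₂)) →
      (Σ Z4 λ s → reduce κ ≡ # 2 ⊗ s) → Σ (Vec₂ n) λ w → Is2mod4 (q K w)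
    use-coordinates (a , b , coords) (s , κ≡2s) =
      compK v , even-digit₀ κ-even , digit₁-of-2 κ (trans κ≡2s (forced (reduce a) (reduce b) s hits-t))
      where
      open ≡-Reasoning
      hits-t : reduce a ⊗ reduce a ⊗ u₁ ⊕ reduce b ⊗ reduce b ⊗ u₂ ⊕ # 2 ⊗ s ≡ t
      hits-t = begin
        reduce a ⊗ reduce a ⊗ u₁ ⊕ reduce b ⊗ reduce b ⊗ u₂ ⊕ # 2 ⊗ s
                                           ≡⟨ sym (cong₂ _⊕_ (q-diagonal-mod4 M v₁ v₂ (compM v) a b v₁⊥v₂ coords) κ≡2s) ⟩
        reduce (q M (compM v)) ⊕ reduce κ  ≡⟨ sym (q-⊥-mod4 n M K v) ⟩
        reduce (q (M ⊥ K) v)               ≡⟨ reduce-≈ (proj₂ (universal (fromℕ (toℕ t)))) ⟩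
        reduce (fromℕ (toℕ t))             ≡⟨ reduce-fromℕ t ⟩
        t                                  ∎

corollary5p3 : (n : ℕ) (M : Lattice 2) (K : Lattice n) →
    ProperUnimodular2 M → ScaleIn2ℤ₂ K →
    Universal (M ⊥ K) → NormEq2ℤ₂ K
corollary5p3 n M K unimodular scale universal z = norm⊆2ℤ₂ , 2ℤ₂⊆norm (value-2mod4 n M K unimodular scale universal)
  where
  norm⊆2ℤ₂ : InIdealGen (QValue K) z → In2ℤ₂ z
  norm⊆2ℤ₂ z∈norm = scale z (norm⊆scale K z z∈norm)
  -- a value κ = q(w) ≡ 2 (mod 4) divides every element of 2ℤ₂
  2ℤ₂⊆norm : (Σ (Vec₂ n) λ w → Is2mod4 (q K w)) → In2ℤ₂ z → InIdealGen (QValue K) z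
  2ℤ₂⊆norm (w , κ≡2) z-even = multiple∈ideal c (w , λ _ → refl) quotient
    where open Quotient (q K w) z κ≡2 (even-digit₀ z-even)
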